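{- Let $R$ be a Prüfer domain and let $M$ be an $\mathfrak{s}$-torsion $R$-module. Then $M$ is $K^{\mathfrak{s}\text{ -Tor}}$-pure-injective if and only if $M$ is torsion-ultracomplete.
   Context: A pp-formula is an existentially quantified finite system of $R$-linear equations; $N\leq_p M$ means pp-formulas with parameters in $N$ true in $M$ are true in $N$. A pp-formula $\psi(x)$ is low if $\psi[R]=0$. $\mathfrak{s}(M)=\{m\in M:M\models\psi[m]$ for some low $\psi\}$; $M$ is $\mathfrak{s}$-torsion if $\mathfrak{s}(M)=M$; $K^{\mathfrak{s}\text{ -Tor}}$ is the class of $\mathfrak{s}$-torsion modules (over a commutative domain these are exactly the torsion modules: every element is annihilated by a nonzero ring element). An $\mathfrak{s}$-torsion $M$ is $K^{\mathfrak{s}\text{ -Tor}}$-pure-injective if for all $N_1\leq_p N_2$ in $K^{\mathfrak{s}\text{ -Tor}}$ every homomorphism $N_1\to M$ extends to $N_2\to M$. $M$ is torsion-ultracomplete if for every module $N$ with $M\leq_p N$ and $N/M\in K^{\mathfrak{s}\text{ -Tor}}$, $M$ is a direct summand of $N$. -}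

module Defs where

open import Level using (Level; _⊔_)
open import Data.Nat using (ℕ; zero; suc)
open import Data.Fin using (Fin; zero; suc)
open import Data.Product using (Σ; ∃; ∃-syntax; _×_; _,_)
open import Data.Sum using (_⊎_)
open import Relation.Nullary using (¬_)
open import Function using (_∘_)
open import Algebra.Bundles using (CommutativeRing)
open import Algebra.Module.Bundles using (Module)
open import Algebra.Module.Construct.TensorUnit using (⟨module⟩)
import Algebra.Module.Morphism.Structures as MorphS

module _ {c ℓr : Level} (R : CommutativeRing c ℓr) where

  open CommutativeRing R using (Carrier; _≈_; _+_; _*_; 0#; 1#)

  IsDomain : Set (c ⊔ ℓr)
  IsDomain = (¬ (1# ≈ 0#)) × (∀ x y → x * y ≈ 0# → (x ≈ 0#) ⊎ (y ≈ 0#))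

  sumR : ∀ {n} → (Fin n → Carrier) → Carrier
  sumR {zero}  f = 0#
  sumR {suc n} f = f zero + sumR (f ∘ suc)

  _∣R_ : Carrier → Carrier → Set (c ⊔ ℓr)
  d ∣R x = ∃[ q ] (q * d ≈ x)

  -- The finitely generated ideal I = (a₀,…,a_{n-1}) is invertible, i.e.
  -- I·(R:I) = R, with elements of the fraction field written as c/d:
  -- there are d ≠ 0 and c₀,…,c_{n-1} with (c_i/d)·I ⊆ R for all i
  -- and Σ (c_i/d)·a_i = 1.
  IsInvertibleFGIdeal : ∀ {n} → (Fin n → Carrier) → Set (c ⊔ ℓr)
  IsInvertibleFGIdeal {n} a =
    Σ Carrier λ d → (¬ (d ≈ 0#)) × (Σ (Fin n → Carrier) λ cs →
      ((∀ i j → d ∣R (cs i * a j)) × (sumR (λ i → cs i * a i) ≈ d)))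

  IsPruferDomain : Set (c ⊔ ℓr)
  IsPruferDomain =
    IsDomain × (∀ n (a : Fin n → Carrier) → ¬ (∀ i → a i ≈ 0#) → IsInvertibleFGIdeal a)

  -- A pp-formula φ(x_0,…,x_{n-1}) = ∃ y_0…y_{k-1}. ⋀_{j<e} Σ_i A j i x_i + Σ_l B j l y_l = 0
  record PPFormula (n : ℕ) : Set c where
    field
      k : ℕ
      e : ℕ
      A : Fin e → Fin n → Carrier
      B : Fin e → Fin k → Carrier

  module _ {m ℓm : Level} (M : Module R m ℓm) where
    open Module M

    sumM : ∀ {n} → (Fin n → Carrierᴹ) → Carrierᴹ
    sumM {zero}  f = 0ᴹ
    sumM {suc n} f = f zero +ᴹ sumM (f ∘ suc)

    ppEqn : ∀ {n} (φ : PPFormula n) → (Fin n → Carrierᴹ)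
          → (Fin (PPFormula.k φ) → Carrierᴹ) → Fin (PPFormula.e φ) → Carrierᴹ
    ppEqn φ x y j = sumM (λ i → A j i *ₗ x i) +ᴹ sumM (λ l → B j l *ₗ y l)
      where open PPFormula φ

    Sat : ∀ {n} → PPFormula n → (Fin n → Carrierᴹ) → Set (m ⊔ ℓm)
    Sat φ x = ∃[ y ] (∀ j → ppEqn φ x y j ≈ᴹ 0ᴹ)

  IsLow : PPFormula 1 → Set (c ⊔ ℓr)
  IsLow ψ = ∀ r → Sat ⟨module⟩ ψ (λ _ → r) → r ≈ 0#

  module _ {m ℓm : Level} (M : Module R m ℓm) where
    open Module M

    In𝔰 : Carrierᴹ → Set (c ⊔ ℓr ⊔ m ⊔ ℓm)
    In𝔰 x = ∃[ ψ ] (IsLow ψ × Sat M ψ (λ _ → x))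

    Is𝔰Torsion : Set (c ⊔ ℓr ⊔ m ⊔ ℓm)
    Is𝔰Torsion = ∀ x → In𝔰 x

  module _ {m₁ ℓm₁ m₂ ℓm₂ : Level} (M : Module R m₁ ℓm₁) (N : Module R m₂ ℓm₂) where
    private
      module M = Module M
      module N = Module N

    IsHom : (M.Carrierᴹ → N.Carrierᴹ) → Set (c ⊔ m₁ ⊔ ℓm₁ ⊔ ℓm₂)
    IsHom = MorphS.ModuleMorphisms.IsModuleHomomorphism M.rawModule N.rawModule

    IsMono : (M.Carrierᴹ → N.Carrierᴹ) → Set (c ⊔ m₁ ⊔ ℓm₁ ⊔ ℓm₂)
    IsMono = MorphS.ModuleMorphisms.IsModuleMonomorphism M.rawModule N.rawModule

    IsPureEmbedding : (M.Carrierᴹ → N.Carrierᴹ) → Set (c ⊔ m₁ ⊔ ℓm₁ ⊔ m₂ ⊔ ℓm₂)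
    IsPureEmbedding ι =
      IsMono ι × (∀ n (φ : PPFormula n) (x : Fin n → M.Carrierᴹ) → Sat N φ (ι ∘ x) → Sat M φ x)

    -- The quotient N/ι(M) is 𝔰-torsion.  Unfolded: N/ι(M) ⊨ ψ[x + ι(M)]
    -- iff there are witnesses y in N such that every equation of ψ holds
    -- modulo ι(M).
    QuotientIs𝔰Torsion : (M.Carrierᴹ → N.Carrierᴹ) → Set (c ⊔ ℓr ⊔ m₁ ⊔ m₂ ⊔ ℓm₂)
    QuotientIs𝔰Torsion ι =
      ∀ (x : N.Carrierᴹ) → ∃[ ψ ] (IsLow ψ ×
        (∃[ y ] (∀ j → ∃[ z ] (ppEqn N ψ (λ _ → x) y j N.≈ᴹ ι z))))

  module _ {m : Level} (M : Module R m m) where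
    private module M = Module M

    IsK𝔰TorPureInjective : Set (c ⊔ ℓr ⊔ Level.suc m)
    IsK𝔰TorPureInjective =
      ∀ (N₁ N₂ : Module R m m) → Is𝔰Torsion N₁ → Is𝔰Torsion N₂ →
      ∀ (ι : Module.Carrierᴹ N₁ → Module.Carrierᴹ N₂) → IsPureEmbedding N₁ N₂ ι →
      ∀ (g : Module.Carrierᴹ N₁ → M.Carrierᴹ) → IsHom N₁ M g →
      ∃[ h ] (IsHom N₂ M h × (∀ x → h (ι x) M.≈ᴹ g x))

    -- M is torsion-ultracomplete: whenever M ≤_p N with N/M 𝔰-torsion,
    -- M is a direct summand of N (i.e. ι has a homomorphic retraction)
    IsTorsionUltracomplete : Set (c ⊔ ℓr ⊔ Level.suc m)
    IsTorsionUltracomplete =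
      ∀ (N : Module R m m) (ι : M.Carrierᴹ → Module.Carrierᴹ N) →
      IsPureEmbedding M N ι → QuotientIs𝔰Torsion M N ι →
      ∃[ π ] (IsHom N M π × (∀ x → π (ι x) M.≈ᴹ x))

-- (⇒) If M ≤ₚ N and N/M is 𝔰-torsion, then N is 𝔰-torsion as well, since 𝔰-torsion modules
-- are closed under extensions; pure-injectivity extends id_M along M ≤ₚ N to a retraction.
-- (⇐) Given N₁ ≤ₚ N₂ and g : N₁ → M, form the pushout P = (M ⊕ N₂)/{(g t, −ι t)}.  The map
-- M → P is a pure embedding and P/M, a quotient of N₂, is 𝔰-torsion, so M is a direct summand
-- of P, and the retraction composed with N₂ → P extends g.

module Submission where

open import Defs
open import Level using (Level; _⊔_)
open import Data.Nat as ℕ using (zero; suc)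
open import Data.Fin using (Fin; zero; suc; _↑ˡ_; _↑ʳ_; splitAt; join)
open import Data.Fin.Properties using (join-splitAt)
open import Data.Vec.Functional using (Vector; _++_)
open import Data.Vec.Functional.Properties using (lookup-++ˡ; lookup-++ʳ; ++-cong)
open import Data.Product using (∃-syntax; _×_; _,_; proj₁; proj₂)
open import Data.Sum using ([_,_])
open import Function using (_∘_; id; flip; _⇔_; mk⇔; Equivalence; Injective)
open Equivalence using (to; from)
open import Relation.Binary.PropositionalEquality using (_≡_; refl; sym; cong; cong₂; subst)
open import Algebra.Bundles using (CommutativeRing; CommutativeMonoid)
open import Algebra.Module.Bundles using (Module)
open import Algebra.Module.Construct.TensorUnit using (⟨module⟩)
open import Algebra.Module.Structures.Biased using (IsModuleFromLeft)
open import Relation.Binary.Core using (Rel)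
import Algebra.Module.Morphism.Structures as MorphismStructures
import Algebra.Module.Morphism.Construct.Composition as Composition
import Algebra.Module.Morphism.Construct.Identity as Identity
import Algebra.Module.Construct.DirectProduct as DirectProduct
open import Data.Sum.Properties using ([,]-∘)

∀-splitAt : ∀ {p} {m n} {P : Fin (m ℕ.+ n) → Set p} →
            (∀ i → P (i ↑ˡ n)) → (∀ i → P (m ↑ʳ i)) → ∀ j → P j
∀-splitAt {m = m} {n} {P} left right j =
  subst P (join-splitAt m n j) ([_,_] {C = P ∘ join m n} left right (splitAt m j))

module _ {c ℓr : Level} (R : CommutativeRing c ℓr) where
  open CommutativeRing R using (_≈_; 0#; 1#) renaming (Carrier to S)
  open PPFormula

  infix 8 _·𝐞_
  _·𝐞_ : ∀ {n} → S → Fin n → Vector S n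
  (c ·𝐞 zero)  zero    = c
  (c ·𝐞 zero)  (suc i) = 0#
  (c ·𝐞 suc p) zero    = 0#
  (c ·𝐞 suc p) (suc i) = (c ·𝐞 p) i

  module Linear {m ℓm : Level} (M : Module R m ℓm) where
    open Module M
    open import Algebra.Properties.CommutativeSemigroup
      (CommutativeMonoid.commutativeSemigroup +ᴹ-commutativeMonoid) using (interchange)
    open import Algebra.Properties.AbelianGroup +ᴹ-abelianGroup using (inverseʳ-unique)
    open import Relation.Binary.Reasoning.Setoid ≈ᴹ-setoid

    sumM-cong : ∀ {n} {f g : Vector Carrierᴹ n} → (∀ i → f i ≈ᴹ g i) → sumM R M f ≈ᴹ sumM R M g
    sumM-cong {zero}  f≈g = ≈ᴹ-refl
    sumM-cong {suc n} f≈g = +ᴹ-cong (f≈g zero) (sumM-cong (f≈g ∘ suc))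

    sumM-0 : ∀ {n} {f : Vector Carrierᴹ n} → (∀ i → f i ≈ᴹ 0ᴹ) → sumM R M f ≈ᴹ 0ᴹ
    sumM-0 {zero}  f≈0 = ≈ᴹ-refl
    sumM-0 {suc n} f≈0 = ≈ᴹ-trans (+ᴹ-cong (f≈0 zero) (sumM-0 (f≈0 ∘ suc))) (+ᴹ-identityˡ 0ᴹ)

    sumM-+ : ∀ {n} (f g : Vector Carrierᴹ n) →
             sumM R M (λ i → f i +ᴹ g i) ≈ᴹ sumM R M f +ᴹ sumM R M g
    sumM-+ {zero}  f g = ≈ᴹ-sym (+ᴹ-identityˡ 0ᴹ)
    sumM-+ {suc n} f g =
      ≈ᴹ-trans (+ᴹ-congˡ (sumM-+ (f ∘ suc) (g ∘ suc))) (interchange _ _ _ _)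

    sumM-↑ : ∀ {m n} (f : Vector Carrierᴹ (m ℕ.+ n)) →
             sumM R M f ≈ᴹ sumM R M (f ∘ (_↑ˡ n)) +ᴹ sumM R M (f ∘ (m ↑ʳ_))
    sumM-↑ {zero}  f = ≈ᴹ-sym (+ᴹ-identityˡ _)
    sumM-↑ {suc m} f = ≈ᴹ-trans (+ᴹ-congˡ (sumM-↑ {m} (f ∘ suc))) (≈ᴹ-sym (+ᴹ-assoc _ _ _))

    -‿distribʳ-*ₗ : ∀ r x → r *ₗ (-ᴹ x) ≈ᴹ -ᴹ (r *ₗ x)
    -‿distribʳ-*ₗ r x = inverseʳ-unique (r *ₗ x) (r *ₗ (-ᴹ x)) (begin
      r *ₗ x +ᴹ r *ₗ (-ᴹ x) ≈⟨ *ₗ-distribˡ r x (-ᴹ x) ⟨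
      r *ₗ (x +ᴹ -ᴹ x)      ≈⟨ *ₗ-congˡ (-ᴹ‿inverseʳ x) ⟩
      r *ₗ 0ᴹ               ≈⟨ *ₗ-zeroʳ r ⟩
      0ᴹ                    ∎)

    infix 7 _·_
    _·_ : ∀ {n} → Vector S n → Vector Carrierᴹ n → Carrierᴹ
    a · v = sumM R M (λ i → a i *ₗ v i)

    ·-congˡ : ∀ {n} {a b : Vector S n} (v : Vector Carrierᴹ n) → (∀ i → a i ≡ b i) → a · v ≈ᴹ b · v
    ·-congˡ v a≡b = sumM-cong (λ i → ≈ᴹ-reflexive (cong (_*ₗ v i) (a≡b i)))

    ·-congʳ : ∀ {n} (a : Vector S n) {u v : Vector Carrierᴹ n} → (∀ i → u i ≈ᴹ v i) → a · u ≈ᴹ a · v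
    ·-congʳ a u≈v = sumM-cong (λ i → *ₗ-congˡ (u≈v i))

    ·-zeroʳ : ∀ {n} (a : Vector S n) → a · (λ _ → 0ᴹ) ≈ᴹ 0ᴹ
    ·-zeroʳ a = sumM-0 (λ i → *ₗ-zeroʳ (a i))

    ·-zeroˡ : ∀ {n} (v : Vector Carrierᴹ n) → (λ _ → 0#) · v ≈ᴹ 0ᴹ
    ·-zeroˡ v = sumM-0 (λ i → *ₗ-zeroˡ (v i))

    ·-distribˡ : ∀ {n} (a : Vector S n) (u v : Vector Carrierᴹ n) →
                 a · (λ i → u i +ᴹ v i) ≈ᴹ a · u +ᴹ a · v
    ·-distribˡ a u v = ≈ᴹ-trans (sumM-cong (λ i → *ₗ-distribˡ (a i) (u i) (v i)))
                                (sumM-+ (λ i → a i *ₗ u i) (λ i → a i *ₗ v i))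

    ·-++ : ∀ {m n} (a : Vector S (m ℕ.+ n)) (u : Vector Carrierᴹ m) (v : Vector Carrierᴹ n) →
           a · (u ++ v) ≈ᴹ (a ∘ (_↑ˡ n)) · u +ᴹ (a ∘ (m ↑ʳ_)) · v
    ·-++ {m} {n} a u v = ≈ᴹ-trans (sumM-↑ {m} _)
      (+ᴹ-cong (·-congʳ (a ∘ (_↑ˡ n)) (≈ᴹ-reflexive ∘ lookup-++ˡ u v))
               (·-congʳ (a ∘ (m ↑ʳ_)) (≈ᴹ-reflexive ∘ lookup-++ʳ u v)))

    ++-· : ∀ {m n} (a : Vector S m) (b : Vector S n) (v : Vector Carrierᴹ (m ℕ.+ n)) →
           (a ++ b) · v ≈ᴹ a · (v ∘ (_↑ˡ n)) +ᴹ b · (v ∘ (m ↑ʳ_))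
    ++-· {m} {n} a b v = ≈ᴹ-trans (sumM-↑ {m} _)
      (+ᴹ-cong (·-congˡ (v ∘ (_↑ˡ n)) (lookup-++ˡ a b)) (·-congˡ (v ∘ (m ↑ʳ_)) (lookup-++ʳ a b)))

    ·𝐞-· : ∀ {n} (c : S) (p : Fin n) (v : Vector Carrierᴹ n) → (c ·𝐞 p) · v ≈ᴹ c *ₗ v p
    ·𝐞-· c zero    v = ≈ᴹ-trans (+ᴹ-congˡ (·-zeroˡ (v ∘ suc))) (+ᴹ-identityʳ _)
    ·𝐞-· c (suc p) v = ≈ᴹ-trans (+ᴹ-cong (*ₗ-zeroˡ _) (·𝐞-· c p (v ∘ suc))) (+ᴹ-identityˡ _)

    ppEqn-cong : ∀ {n} (φ : PPFormula R n) {x x' : Vector Carrierᴹ n} {y y'} →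
                 (∀ i → x i ≈ᴹ x' i) → (∀ l → y l ≈ᴹ y' l) →
                 ∀ j → ppEqn R M φ x y j ≈ᴹ ppEqn R M φ x' y' j
    ppEqn-cong φ x≈x' y≈y' j = +ᴹ-cong (·-congʳ (A φ j) x≈x') (·-congʳ (B φ j) y≈y')

    Sat-cong : ∀ {n} (φ : PPFormula R n) {x x' : Vector Carrierᴹ n} →
               (∀ i → x i ≈ᴹ x' i) → Sat R M φ x → Sat R M φ x'
    Sat-cong φ x≈x' (y , eqs) =
      y , λ j → ≈ᴹ-trans (ppEqn-cong φ (≈ᴹ-sym ∘ x≈x') (λ _ → ≈ᴹ-refl) j) (eqs j)

    ppEqn-+ʸ : ∀ {n} (φ : PPFormula R n) x (y y' : Vector Carrierᴹ (k φ)) j →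
               ppEqn R M φ x (λ l → y l +ᴹ y' l) j ≈ᴹ ppEqn R M φ x y j +ᴹ B φ j · y'
    ppEqn-+ʸ φ x y y' j =
      ≈ᴹ-trans (+ᴹ-congˡ (·-distribˡ (B φ j) y y')) (≈ᴹ-sym (+ᴹ-assoc _ _ _))

    ppEqn-0ˣ : ∀ {n} (φ : PPFormula R n) y j → ppEqn R M φ (λ _ → 0ᴹ) y j ≈ᴹ B φ j · y
    ppEqn-0ˣ φ y j = ≈ᴹ-trans (+ᴹ-congʳ (·-zeroʳ (A φ j))) (+ᴹ-identityˡ _)

  module _ {m₁ ℓ₁ m₂ ℓ₂ : Level} (M : Module R m₁ ℓ₁) (N : Module R m₂ ℓ₂)
           (f : Module.Carrierᴹ M → Module.Carrierᴹ N) where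
    private
      module M = Module M
      module N = Module N
      module PN = Linear N
    open import Algebra.Properties.AbelianGroup N.+ᴹ-abelianGroup using (inverseʳ-unique)
    open import Relation.Binary.Reasoning.Setoid N.≈ᴹ-setoid

    mkIsHom : (∀ {a b} → a M.≈ᴹ b → f a N.≈ᴹ f b) →
              (∀ a b → f (a M.+ᴹ b) N.≈ᴹ f a N.+ᴹ f b) →
              (∀ r a → f (r M.*ₗ a) N.≈ᴹ r N.*ₗ f a) →
              IsHom R M N f
    mkIsHom f-cong +-homo *ₗ-homo = record { isBimoduleHomomorphism = record
      { +ᴹ-isGroupHomomorphism = record
        { isMonoidHomomorphism = record
          { isMagmaHomomorphism = record { isRelHomomorphism = record { cong = f-cong } ; homo = +-homo }
          ; ε-homo = 0-homo }
        ; ⁻¹-homo = λ a → inverseʳ-unique (f a) (f (M.-ᴹ a)) (begin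
            f a N.+ᴹ f (M.-ᴹ a) ≈⟨ +-homo a (M.-ᴹ a) ⟨
            f (a M.+ᴹ M.-ᴹ a)   ≈⟨ f-cong (M.-ᴹ‿inverseʳ a) ⟩
            f M.0ᴹ              ≈⟨ 0-homo ⟩
            N.0ᴹ                ∎) }
      ; *ₗ-homo = *ₗ-homo
      ; *ᵣ-homo = λ r a → begin
          f (a M.*ᵣ r) ≈⟨ f-cong (M.*ₗ-*ᵣ-coincident r a) ⟨
          f (r M.*ₗ a) ≈⟨ *ₗ-homo r a ⟩
          r N.*ₗ f a   ≈⟨ N.*ₗ-*ᵣ-coincident r (f a) ⟩
          f a N.*ᵣ r   ∎ } }
      where
      0-homo : f M.0ᴹ N.≈ᴹ N.0ᴹ
      0-homo = begin
        f M.0ᴹ            ≈⟨ f-cong (M.*ₗ-zeroˡ M.0ᴹ) ⟨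
        f (0# M.*ₗ M.0ᴹ)  ≈⟨ *ₗ-homo 0# M.0ᴹ ⟩
        0# N.*ₗ f M.0ᴹ    ≈⟨ N.*ₗ-zeroˡ (f M.0ᴹ) ⟩
        N.0ᴹ              ∎

    module _ (f-hom : IsHom R M N f) where
      open MorphismStructures.ModuleMorphisms.IsModuleHomomorphism f-hom

      hom-sumM : ∀ {n} (v : Vector M.Carrierᴹ n) → f (sumM R M v) N.≈ᴹ sumM R N (f ∘ v)
      hom-sumM {zero}  v = 0ᴹ-homo
      hom-sumM {suc n} v = N.≈ᴹ-trans (+ᴹ-homo _ _) (N.+ᴹ-congˡ (hom-sumM (v ∘ suc)))

      hom-· : ∀ {n} (a : Vector S n) v → f (Linear._·_ M a v) N.≈ᴹ a PN.· (f ∘ v)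
      hom-· a v =
        N.≈ᴹ-trans (hom-sumM (λ i → a i M.*ₗ v i)) (PN.sumM-cong (λ i → *ₗ-homo (a i) (v i)))

      hom-ppEqn : ∀ {n} (φ : PPFormula R n) x y j →
                  f (ppEqn R M φ x y j) N.≈ᴹ ppEqn R N φ (f ∘ x) (f ∘ y) j
      hom-ppEqn φ x y j =
        N.≈ᴹ-trans (+ᴹ-homo _ _) (N.+ᴹ-cong (hom-· (A φ j) x) (hom-· (B φ j) y))

      Sat-hom : ∀ {n} (φ : PPFormula R n) x → Sat R M φ x → Sat R N φ (f ∘ x)
      Sat-hom φ x (y , eqs) = f ∘ y , λ j →
        N.≈ᴹ-trans (N.≈ᴹ-sym (hom-ppEqn φ x y j)) (N.≈ᴹ-trans (⟦⟧-cong (eqs j)) 0ᴹ-homo)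

  ReflectsPP : ∀ {m₁ ℓ₁ m₂ ℓ₂} (M : Module R m₁ ℓ₁) (N : Module R m₂ ℓ₂) →
               (Module.Carrierᴹ M → Module.Carrierᴹ N) → Set _
  ReflectsPP M N ι = ∀ n (φ : PPFormula R n) x → Sat R N φ (ι ∘ x) → Sat R M φ x

  ∃⟨_⟩ : ∀ {n} d → PPFormula R (d ℕ.+ n) → PPFormula R n
  ∃⟨_⟩ {n} d φ = record
    { k = d ℕ.+ k φ ; e = e φ
    ; A = λ j → A φ j ∘ (d ↑ʳ_)
    ; B = λ j → (A φ j ∘ (_↑ˡ n)) ++ B φ j }

  private
    0s : ∀ {n} → Vector S n
    0s _ = 0#

  infixr 6 _∧_
  _∧_ : ∀ {n} → PPFormula R n → PPFormula R n → PPFormula R n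
  φ ∧ ψ = record
    { k = k φ ℕ.+ k ψ ; e = e φ ℕ.+ e ψ
    ; A = A φ ++ A ψ
    ; B = (λ j → B φ j ++ 0s) ++ (λ j → 0s ++ B ψ j) }

  ⊤ : ∀ {n} → PPFormula R n
  ⊤ = record { k = 0 ; e = 0 ; A = λ () ; B = λ () }

  ⋀ : ∀ {n r} → (Fin r → PPFormula R n) → PPFormula R n
  ⋀ {r = zero}  φs = ⊤
  ⋀ {r = suc r} φs = φs zero ∧ ⋀ (φs ∘ suc)

  infix 7 _at_
  _at_ : ∀ {n} → PPFormula R 1 → Fin n → PPFormula R n
  φ at p = record { k = k φ ; e = e φ ; A = λ j → A φ j zero ·𝐞 p ; B = B φ }

  offset : ∀ {n} (φ : PPFormula R n) → PPFormula R (e φ ℕ.+ n)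
  offset φ = record { k = k φ ; e = e φ ; A = λ j → (1# ·𝐞 j) ++ A φ j ; B = B φ }

  module Semantics {m ℓm : Level} (M : Module R m ℓm) where
    open Module M
    open Linear M
    open import Algebra.Properties.CommutativeSemigroup
      (CommutativeMonoid.commutativeSemigroup +ᴹ-commutativeMonoid) using (x∙yz≈yx∙z; xy∙z≈yz∙x)
    open import Relation.Binary.Reasoning.Setoid ≈ᴹ-setoid

    private
      ⟦_⟧ : ∀ {n} (φ : PPFormula R n) →
            Vector Carrierᴹ n → Vector Carrierᴹ (k φ) → Fin (e φ) → Carrierᴹ
      ⟦_⟧ = ppEqn R M

      ⊨ : ∀ {n} → PPFormula R n → Vector Carrierᴹ n → Set _
      ⊨ = Sat R M

    ppEqn-∃ : ∀ {d n} (φ : PPFormula R (d ℕ.+ n)) x y j →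
              ⟦ ∃⟨ d ⟩ φ ⟧ x y j ≈ᴹ ⟦ φ ⟧ ((y ∘ (_↑ˡ k φ)) ++ x) (y ∘ (d ↑ʳ_)) j
    ppEqn-∃ {d} {n} φ x y j = begin
      a∘↑ʳ · x +ᴹ (a∘↑ˡ ++ B φ j) · y              ≈⟨ +ᴹ-congˡ (++-· a∘↑ˡ (B φ j) y) ⟩
      a∘↑ʳ · x +ᴹ (a∘↑ˡ · w +ᴹ B φ j · y∘↑ʳ)       ≈⟨ x∙yz≈yx∙z _ _ _ ⟩
      (a∘↑ˡ · w +ᴹ a∘↑ʳ · x) +ᴹ B φ j · y∘↑ʳ       ≈⟨ +ᴹ-congʳ (·-++ (A φ j) w x) ⟨
      A φ j · (w ++ x) +ᴹ B φ j · y∘↑ʳ             ∎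
      where
      a∘↑ˡ = A φ j ∘ (_↑ˡ n)
      a∘↑ʳ = A φ j ∘ (d ↑ʳ_)
      w = y ∘ (_↑ˡ k φ)
      y∘↑ʳ = y ∘ (d ↑ʳ_)

    Sat-∃ : ∀ {d n} (φ : PPFormula R (d ℕ.+ n)) x → ⊨ (∃⟨ d ⟩ φ) x ⇔ (∃[ w ] ⊨ φ (w ++ x))
    Sat-∃ {d} φ x = mk⇔
      (λ (y , eqs) → y ∘ (_↑ˡ k φ) , y ∘ (d ↑ʳ_) ,
        λ j → ≈ᴹ-trans (≈ᴹ-sym (ppEqn-∃ φ x y j)) (eqs j))
      (λ (w , y , eqs) → w ++ y , λ j → ≈ᴹ-trans (ppEqn-∃ φ x (w ++ y) j)
         (≈ᴹ-trans (ppEqn-cong φ (≈ᴹ-reflexive ∘ ++-cong _ w (lookup-++ˡ w y) (λ _ → refl))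
                                 (≈ᴹ-reflexive ∘ lookup-++ʳ w y) j) (eqs j)))

    ppEqn-∧ˡ : ∀ {n} (φ ψ : PPFormula R n) x y j →
               ⟦ φ ∧ ψ ⟧ x y (j ↑ˡ e ψ) ≈ᴹ ⟦ φ ⟧ x (y ∘ (_↑ˡ k ψ)) j
    ppEqn-∧ˡ φ ψ x y j = begin
      ⟦ φ ∧ ψ ⟧ x y (j ↑ˡ e ψ)
        ≡⟨ cong₂ (λ a b → a · x +ᴹ b · y) (lookup-++ˡ (A φ) (A ψ) j) (lookup-++ˡ Bs₁ Bs₂ j) ⟩
      A φ j · x +ᴹ (B φ j ++ 0s) · y
        ≈⟨ +ᴹ-congˡ (++-· (B φ j) 0s y) ⟩
      A φ j · x +ᴹ (B φ j · (y ∘ (_↑ˡ k ψ)) +ᴹ 0s · (y ∘ (k φ ↑ʳ_)))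
        ≈⟨ +ᴹ-congˡ (≈ᴹ-trans (+ᴹ-congˡ (·-zeroˡ (y ∘ (k φ ↑ʳ_)))) (+ᴹ-identityʳ _)) ⟩
      ⟦ φ ⟧ x (y ∘ (_↑ˡ k ψ)) j ∎
      where
      Bs₁ = λ j → B φ j ++ 0s
      Bs₂ = λ j → 0s ++ B ψ j

    ppEqn-∧ʳ : ∀ {n} (φ ψ : PPFormula R n) x y j →
               ⟦ φ ∧ ψ ⟧ x y (e φ ↑ʳ j) ≈ᴹ ⟦ ψ ⟧ x (y ∘ (k φ ↑ʳ_)) j
    ppEqn-∧ʳ φ ψ x y j = begin
      ⟦ φ ∧ ψ ⟧ x y (e φ ↑ʳ j)
        ≡⟨ cong₂ (λ a b → a · x +ᴹ b · y) (lookup-++ʳ (A φ) (A ψ) j) (lookup-++ʳ Bs₁ Bs₂ j) ⟩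
      A ψ j · x +ᴹ (0s ++ B ψ j) · y
        ≈⟨ +ᴹ-congˡ (++-· 0s (B ψ j) y) ⟩
      A ψ j · x +ᴹ (0s · (y ∘ (_↑ˡ k ψ)) +ᴹ B ψ j · (y ∘ (k φ ↑ʳ_)))
        ≈⟨ +ᴹ-congˡ (≈ᴹ-trans (+ᴹ-congʳ (·-zeroˡ (y ∘ (_↑ˡ k ψ)))) (+ᴹ-identityˡ _)) ⟩
      ⟦ ψ ⟧ x (y ∘ (k φ ↑ʳ_)) j ∎
      where
      Bs₁ = λ j → B φ j ++ 0s
      Bs₂ = λ j → 0s ++ B ψ j

    Sat-∧ : ∀ {n} (φ ψ : PPFormula R n) x → ⊨ (φ ∧ ψ) x ⇔ (⊨ φ x × ⊨ ψ x)
    Sat-∧ φ ψ x = mk⇔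
      (λ (y , eqs) →
        (y ∘ (_↑ˡ k ψ) , λ j → ≈ᴹ-trans (≈ᴹ-sym (ppEqn-∧ˡ φ ψ x y j)) (eqs (j ↑ˡ e ψ))) ,
        (y ∘ (k φ ↑ʳ_) , λ j → ≈ᴹ-trans (≈ᴹ-sym (ppEqn-∧ʳ φ ψ x y j)) (eqs (e φ ↑ʳ j))))
      (λ ((y₁ , eqs₁) , (y₂ , eqs₂)) → y₁ ++ y₂ , ∀-splitAt
        (λ j → ≈ᴹ-trans (ppEqn-∧ˡ φ ψ x (y₁ ++ y₂) j)
                 (≈ᴹ-trans (ppEqn-cong φ (λ _ → ≈ᴹ-refl) (≈ᴹ-reflexive ∘ lookup-++ˡ y₁ y₂) j)
                           (eqs₁ j)))
        (λ j → ≈ᴹ-trans (ppEqn-∧ʳ φ ψ x (y₁ ++ y₂) j)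
                 (≈ᴹ-trans (ppEqn-cong ψ (λ _ → ≈ᴹ-refl) (≈ᴹ-reflexive ∘ lookup-++ʳ y₁ y₂) j)
                           (eqs₂ j))))

    Sat-⋀ : ∀ {n r} (φs : Fin r → PPFormula R n) x → ⊨ (⋀ φs) x ⇔ (∀ j → ⊨ (φs j) x)
    Sat-⋀ {r = zero}  φs x = mk⇔ (λ _ ()) (λ _ → (λ ()) , (λ ()))
    Sat-⋀ {r = suc r} φs x = mk⇔
      (λ sat → let (sat₀ , sat₊) = to (Sat-∧ (φs zero) (⋀ (φs ∘ suc)) x) sat in
        λ { zero → sat₀ ; (suc j) → to (Sat-⋀ (φs ∘ suc) x) sat₊ j })
      (λ sats → from (Sat-∧ (φs zero) (⋀ (φs ∘ suc)) x)
                     (sats zero , from (Sat-⋀ (φs ∘ suc) x) (sats ∘ suc)))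

    ppEqn-at : ∀ {n} (φ : PPFormula R 1) (p : Fin n) x y j →
               ⟦ φ at p ⟧ x y j ≈ᴹ ⟦ φ ⟧ (λ _ → x p) y j
    ppEqn-at φ p x y j = +ᴹ-congʳ (≈ᴹ-trans (·𝐞-· (A φ j zero) p x) (≈ᴹ-sym (+ᴹ-identityʳ _)))

    Sat-at : ∀ {n} (φ : PPFormula R 1) (p : Fin n) x → ⊨ (φ at p) x ⇔ ⊨ φ (λ _ → x p)
    Sat-at φ p x = mk⇔
      (λ (y , eqs) → y , λ j → ≈ᴹ-trans (≈ᴹ-sym (ppEqn-at φ p x y j)) (eqs j))
      (λ (y , eqs) → y , λ j → ≈ᴹ-trans (ppEqn-at φ p x y j) (eqs j))

    ppEqn-offset : ∀ {n} (φ : PPFormula R n) w x y j →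
                   ⟦ offset φ ⟧ (w ++ x) y j ≈ᴹ ⟦ φ ⟧ x y j +ᴹ w j
    ppEqn-offset {n} φ w x y j = begin
      ((1# ·𝐞 j) ++ A φ j) · (w ++ x) +ᴹ B φ j · y
        ≈⟨ +ᴹ-congʳ (++-· (1# ·𝐞 j) (A φ j) (w ++ x)) ⟩
      ((1# ·𝐞 j) · ((w ++ x) ∘ (_↑ˡ n)) +ᴹ A φ j · ((w ++ x) ∘ (e φ ↑ʳ_))) +ᴹ B φ j · y
        ≈⟨ +ᴹ-congʳ (+ᴹ-cong (≈ᴹ-trans (·𝐞-· 1# j _) (*ₗ-identityˡ _))
                             (·-congʳ (A φ j) (≈ᴹ-reflexive ∘ lookup-++ʳ w x))) ⟩
      ((w ++ x) (j ↑ˡ n) +ᴹ A φ j · x) +ᴹ B φ j · y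
        ≈⟨ xy∙z≈yz∙x _ _ _ ⟩
      ⟦ φ ⟧ x y j +ᴹ (w ++ x) (j ↑ˡ n)
        ≡⟨ cong (⟦ φ ⟧ x y j +ᴹ_) (lookup-++ˡ w x j) ⟩
      ⟦ φ ⟧ x y j +ᴹ w j ∎

    Sat-offset : ∀ {n} (φ : PPFormula R n) w x →
                 ⊨ (offset φ) (w ++ x) ⇔ (∃[ y ] ∀ j → ⟦ φ ⟧ x y j +ᴹ w j ≈ᴹ 0ᴹ)
    Sat-offset φ w x = mk⇔
      (λ (y , eqs) → y , λ j → ≈ᴹ-trans (≈ᴹ-sym (ppEqn-offset φ w x y j)) (eqs j))
      (λ (y , eqs) → y , λ j → ≈ᴹ-trans (ppEqn-offset φ w x y j) (eqs j))

  -- x satisfies the low formula ψ modulo ι(M), with residues ι zⱼ, and each −zⱼ satisfies a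
  -- low formula ψⱼ.  So χ(x) := ∃w. (ψ's equations at x, offset by w) ∧ ⋀ⱼ ψⱼ(wⱼ) holds in N
  -- with w = ι(−z), and χ is low: in R every wⱼ vanishes, which leaves ψ(r).
  module Extension {m₁ ℓ₁ m₂ ℓ₂ : Level} {M : Module R m₁ ℓ₁} {N : Module R m₂ ℓ₂}
                   {ι : Module.Carrierᴹ M → Module.Carrierᴹ N} (ι-hom : IsHom R M N ι)
                   (M-tor : Is𝔰Torsion R M) (ψ : PPFormula R 1) (x : Module.Carrierᴹ N)
                   (y : Vector (Module.Carrierᴹ N) (k ψ))
                   (residue : ∀ j → ∃[ z ] Module._≈ᴹ_ N (ppEqn R N ψ (λ _ → x) y j) (ι z))
                   where
    private
      module M = Module M
      module N = Module N
      module ℛ = Module (⟨module⟩ {R = R})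
    open MorphismStructures.ModuleMorphisms.IsModuleHomomorphism ι-hom

    z : Fin (e ψ) → M.Carrierᴹ
    z j = proj₁ (residue j)

    ψs : Fin (e ψ) → PPFormula R 1
    ψs j = proj₁ (M-tor (M.-ᴹ z j))

    ψs-at : Fin (e ψ) → PPFormula R (e ψ ℕ.+ 1)
    ψs-at j = ψs j at (j ↑ˡ 1)

    χ : PPFormula R 1
    χ = ∃⟨ e ψ ⟩ (offset ψ ∧ ⋀ ψs-at)

    χ-sat : Sat R N χ (λ _ → x)
    χ-sat = from (Sat-∃ (offset ψ ∧ ⋀ ψs-at) x⃗)
      (w , from (Sat-∧ (offset ψ) (⋀ ψs-at) (w ++ x⃗))
                (offset-sat , from (Sat-⋀ ψs-at (w ++ x⃗)) ψs-sat))
      where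
      open Semantics N
      x⃗ : Vector N.Carrierᴹ 1
      x⃗ _ = x
      w : Fin (e ψ) → N.Carrierᴹ
      w j = ι (M.-ᴹ z j)
      offset-sat : Sat R N (offset ψ) (w ++ x⃗)
      offset-sat = from (Sat-offset ψ w x⃗) (y , λ j → N.≈ᴹ-trans
        (N.+ᴹ-congʳ (proj₂ (residue j)))
        (N.≈ᴹ-trans (N.≈ᴹ-sym (+ᴹ-homo (z j) (M.-ᴹ z j)))
          (N.≈ᴹ-trans (⟦⟧-cong (M.-ᴹ‿inverseʳ (z j))) 0ᴹ-homo)))
      ψs-sat : ∀ j → Sat R N (ψs-at j) (w ++ x⃗)
      ψs-sat j = from (Sat-at (ψs j) (j ↑ˡ 1) (w ++ x⃗))
        (Linear.Sat-cong N (ψs j) (λ _ → N.≈ᴹ-reflexive (sym (lookup-++ˡ w x⃗ j)))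
          (Sat-hom M N ι ι-hom (ψs j) (λ _ → M.-ᴹ z j) (proj₂ (proj₂ (M-tor (M.-ᴹ z j))))))

    χ-low : IsLow R ψ → IsLow R χ
    χ-low ψ-low r sat = ψ-low r (y′ , λ j → ℛ.≈ᴹ-trans (ℛ.≈ᴹ-sym (ℛ.+ᴹ-identityʳ _))
                                       (ℛ.≈ᴹ-trans (ℛ.+ᴹ-congˡ (ℛ.≈ᴹ-sym (w≈0 j))) (eqs j)))
      where
      open Semantics ⟨module⟩
      r⃗ : Vector S 1
      r⃗ _ = r
      w,sat₀ = to (Sat-∃ (offset ψ ∧ ⋀ ψs-at) r⃗) sat
      w = proj₁ w,sat₀
      sat₀ = to (Sat-∧ (offset ψ) (⋀ ψs-at) (w ++ r⃗)) (proj₂ w,sat₀)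
      y′ = proj₁ (to (Sat-offset ψ w r⃗) (proj₁ sat₀))
      eqs = proj₂ (to (Sat-offset ψ w r⃗) (proj₁ sat₀))
      w≈0 : ∀ j → w j ℛ.≈ᴹ ℛ.0ᴹ
      w≈0 j = proj₁ (proj₂ (M-tor (M.-ᴹ z j))) (w j)
        (Linear.Sat-cong ⟨module⟩ (ψs j) (λ _ → ℛ.≈ᴹ-reflexive (lookup-++ˡ w r⃗ j))
          (to (Sat-at (ψs j) (j ↑ˡ 1) (w ++ r⃗)) (to (Sat-⋀ ψs-at (w ++ r⃗)) (proj₂ sat₀) j)))

  Is𝔰Torsion-extension : ∀ {m₁ ℓ₁ m₂ ℓ₂} {M : Module R m₁ ℓ₁} {N : Module R m₂ ℓ₂}
                         {ι : Module.Carrierᴹ M → Module.Carrierᴹ N} → IsHom R M N ι →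
                         Is𝔰Torsion R M → QuotientIs𝔰Torsion R M N ι → Is𝔰Torsion R N
  Is𝔰Torsion-extension ι-hom M-tor N/M-tor x with N/M-tor x
  ... | ψ , ψ-low , y , residue = χ , χ-low ψ-low , χ-sat
    where open Extension ι-hom M-tor ψ x y residue

  module Cokernel {k ℓk x ℓx : Level} {K : Module R k ℓk} {X : Module R x ℓx}
                  {f : Module.Carrierᴹ K → Module.Carrierᴹ X} (f-hom : IsHom R K X f) where
    private
      module K = Module K
    open Module X
    open MorphismStructures.ModuleMorphisms.IsModuleHomomorphism f-hom
    open import Algebra.Properties.CommutativeSemigroup
      (CommutativeMonoid.commutativeSemigroup +ᴹ-commutativeMonoid) using (interchange)
    open import Algebra.Properties.AbelianGroup +ᴹ-abelianGroup using (⁻¹-∙-comm)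
    open import Relation.Binary.Reasoning.Setoid ≈ᴹ-setoid

    infix 4 _≈f_
    _≈f_ : Rel Carrierᴹ (k ⊔ ℓx)
    u ≈f v = ∃[ t ] (u ≈ᴹ v +ᴹ f t)

    ≈ᴹ⇒≈f : ∀ {u v} → u ≈ᴹ v → u ≈f v
    ≈ᴹ⇒≈f {u} {v} u≈v = K.0ᴹ , (begin
      u             ≈⟨ u≈v ⟩
      v             ≈⟨ +ᴹ-identityʳ v ⟨
      v +ᴹ 0ᴹ       ≈⟨ +ᴹ-congˡ 0ᴹ-homo ⟨
      v +ᴹ f K.0ᴹ   ∎)

    ≈f-sym : ∀ {u v} → u ≈f v → v ≈f u
    ≈f-sym {u} {v} (t , u≈v+ft) = K.-ᴹ t , (begin
      v                          ≈⟨ +ᴹ-identityʳ v ⟨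
      v +ᴹ 0ᴹ                    ≈⟨ +ᴹ-congˡ (-ᴹ‿inverseʳ (f t)) ⟨
      v +ᴹ (f t +ᴹ -ᴹ f t)       ≈⟨ +ᴹ-assoc v (f t) (-ᴹ f t) ⟨
      (v +ᴹ f t) +ᴹ -ᴹ f t       ≈⟨ +ᴹ-cong u≈v+ft (-ᴹ-homo t) ⟨
      u +ᴹ f (K.-ᴹ t)            ∎)

    ≈f-trans : ∀ {u v w} → u ≈f v → v ≈f w → u ≈f w
    ≈f-trans {u} {v} {w} (t , u≈v+ft) (t′ , v≈w+ft′) = t′ K.+ᴹ t , (begin
      u                     ≈⟨ u≈v+ft ⟩
      v +ᴹ f t              ≈⟨ +ᴹ-congʳ v≈w+ft′ ⟩
      (w +ᴹ f t′) +ᴹ f t    ≈⟨ +ᴹ-assoc w (f t′) (f t) ⟩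
      w +ᴹ (f t′ +ᴹ f t)    ≈⟨ +ᴹ-congˡ (+ᴹ-homo t′ t) ⟨
      w +ᴹ f (t′ K.+ᴹ t)    ∎)

    +ᴹ-cong-≈f : ∀ {u u′ v v′} → u ≈f u′ → v ≈f v′ → u +ᴹ v ≈f u′ +ᴹ v′
    +ᴹ-cong-≈f {u} {u′} {v} {v′} (t , u≈) (t′ , v≈) = t K.+ᴹ t′ , (begin
      u +ᴹ v                          ≈⟨ +ᴹ-cong u≈ v≈ ⟩
      (u′ +ᴹ f t) +ᴹ (v′ +ᴹ f t′)     ≈⟨ interchange u′ (f t) v′ (f t′) ⟩
      (u′ +ᴹ v′) +ᴹ (f t +ᴹ f t′)     ≈⟨ +ᴹ-congˡ (+ᴹ-homo t t′) ⟨
      (u′ +ᴹ v′) +ᴹ f (t K.+ᴹ t′)     ∎)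

    *ₗ-cong-≈f : ∀ {r r′ u u′} → r ≈ r′ → u ≈f u′ → r *ₗ u ≈f r′ *ₗ u′
    *ₗ-cong-≈f {r} {r′} {u} {u′} r≈r′ (t , u≈) = r′ K.*ₗ t , (begin
      r *ₗ u                    ≈⟨ *ₗ-cong r≈r′ u≈ ⟩
      r′ *ₗ (u′ +ᴹ f t)         ≈⟨ *ₗ-distribˡ r′ u′ (f t) ⟩
      r′ *ₗ u′ +ᴹ r′ *ₗ f t     ≈⟨ +ᴹ-congˡ (*ₗ-homo r′ t) ⟨
      r′ *ₗ u′ +ᴹ f (r′ K.*ₗ t) ∎)

    -ᴹ‿cong-≈f : ∀ {u u′} → u ≈f u′ → -ᴹ u ≈f -ᴹ u′
    -ᴹ‿cong-≈f {u} {u′} (t , u≈) = K.-ᴹ t , (begin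
      -ᴹ u                   ≈⟨ -ᴹ‿cong u≈ ⟩
      -ᴹ (u′ +ᴹ f t)         ≈⟨ ⁻¹-∙-comm u′ (f t) ⟨
      -ᴹ u′ +ᴹ -ᴹ f t        ≈⟨ +ᴹ-congˡ (-ᴹ-homo t) ⟨
      -ᴹ u′ +ᴹ f (K.-ᴹ t)    ∎)

    coker : Module R x (k ⊔ ℓx)
    coker = record
      { Carrierᴹ = Carrierᴹ ; _≈ᴹ_ = _≈f_ ; _+ᴹ_ = _+ᴹ_ ; _*ₗ_ = _*ₗ_ ; _*ᵣ_ = flip _*ₗ_
      ; 0ᴹ = 0ᴹ ; -ᴹ_ = -ᴹ_
      ; isModule = IsModuleFromLeft.isModule {commutativeRing = R} (record { isLeftModule = record
        { isLeftSemimodule = record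
          { +ᴹ-isCommutativeMonoid = record
            { isMonoid = record
              { isSemigroup = record
                { isMagma = record
                  { isEquivalence = record { refl = ≈ᴹ⇒≈f ≈ᴹ-refl ; sym = ≈f-sym ; trans = ≈f-trans }
                  ; ∙-cong = +ᴹ-cong-≈f }
                ; assoc = λ u v w → ≈ᴹ⇒≈f (+ᴹ-assoc u v w) }
              ; identity = (≈ᴹ⇒≈f ∘ +ᴹ-identityˡ) , (≈ᴹ⇒≈f ∘ +ᴹ-identityʳ) }
            ; comm = λ u v → ≈ᴹ⇒≈f (+ᴹ-comm u v) }
          ; isPreleftSemimodule = record
            { *ₗ-cong = *ₗ-cong-≈f
            ; *ₗ-zeroˡ = ≈ᴹ⇒≈f ∘ *ₗ-zeroˡ
            ; *ₗ-distribʳ = λ u r s → ≈ᴹ⇒≈f (*ₗ-distribʳ u r s)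
            ; *ₗ-identityˡ = ≈ᴹ⇒≈f ∘ *ₗ-identityˡ
            ; *ₗ-assoc = λ r s u → ≈ᴹ⇒≈f (*ₗ-assoc r s u)
            ; *ₗ-zeroʳ = ≈ᴹ⇒≈f ∘ *ₗ-zeroʳ
            ; *ₗ-distribˡ = λ r u v → ≈ᴹ⇒≈f (*ₗ-distribˡ r u v) } }
        ; -ᴹ‿cong = -ᴹ‿cong-≈f
        ; -ᴹ‿inverse = (≈ᴹ⇒≈f ∘ -ᴹ‿inverseˡ) , (≈ᴹ⇒≈f ∘ -ᴹ‿inverseʳ) } })
      }

    sumM-coker : ∀ {n} (v : Vector Carrierᴹ n) → sumM R coker v ≡ sumM R X v
    sumM-coker {zero}  v = refl
    sumM-coker {suc n} v = cong (v zero +ᴹ_) (sumM-coker (v ∘ suc))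

    ppEqn-coker : ∀ {n} (φ : PPFormula R n) x y j → ppEqn R coker φ x y j ≡ ppEqn R X φ x y j
    ppEqn-coker φ x y j =
      cong₂ _+ᴹ_ (sumM-coker (λ i → A φ j i *ₗ x i)) (sumM-coker (λ l → B φ j l *ₗ y l))

  module _ {n₁ ℓ₁ n₂ ℓ₂ : Level} {N₁ : Module R n₁ ℓ₁} {N₂ : Module R n₂ ℓ₂}
           {ι : Module.Carrierᴹ N₁ → Module.Carrierᴹ N₂} (ι-hom : IsHom R N₁ N₂ ι) where
    private
      module N₁ = Module N₁
      module N₂ = Module N₂
      module ι = MorphismStructures.ModuleMorphisms.IsModuleHomomorphism ι-hom

    pure-reflects-offset : ReflectsPP N₁ N₂ ι →
      ∀ {n} (φ : PPFormula R n) (t : Fin (e φ) → N₁.Carrierᴹ) →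
      (∃[ v ] ∀ j → ppEqn R N₂ φ (λ _ → N₂.0ᴹ) v j N₂.+ᴹ ι (t j) N₂.≈ᴹ N₂.0ᴹ) →
      ∃[ v ] ∀ j → ppEqn R N₁ φ (λ _ → N₁.0ᴹ) v j N₁.+ᴹ t j N₁.≈ᴹ N₁.0ᴹ
    pure-reflects-offset ι-pure {n} φ t (v , eqs) =
      to (Semantics.Sat-offset N₁ φ t 0⃗) (ι-pure _ (offset φ) (t ++ 0⃗) offset-sat)
      where
      0⃗ : Vector N₁.Carrierᴹ n
      0⃗ _ = N₁.0ᴹ
      offset-sat : Sat R N₂ (offset φ) (ι ∘ (t ++ 0⃗))
      offset-sat =
        Linear.Sat-cong N₂ (offset φ) (λ i → N₂.≈ᴹ-reflexive (sym ([,]-∘ ι (splitAt (e φ) i))))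
          (from (Semantics.Sat-offset N₂ φ (ι ∘ t) (ι ∘ 0⃗)) (v , λ j → N₂.≈ᴹ-trans
            (N₂.+ᴹ-congʳ (Linear.ppEqn-cong N₂ φ (λ _ → ι.0ᴹ-homo) (λ _ → N₂.≈ᴹ-refl) j))
            (eqs j)))

  module Pushout {m ℓm n₁ ℓ₁ n₂ ℓ₂ : Level}
                 {M : Module R m ℓm} {N₁ : Module R n₁ ℓ₁} {N₂ : Module R n₂ ℓ₂}
                 {ι : Module.Carrierᴹ N₁ → Module.Carrierᴹ N₂} (ι-hom : IsHom R N₁ N₂ ι)
                 {g : Module.Carrierᴹ N₁ → Module.Carrierᴹ M} (g-hom : IsHom R N₁ M g) where
    private
      module M = Module M
      module N₁ = Module N₁
      module N₂ = Module N₂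
      module ι = MorphismStructures.ModuleMorphisms.IsModuleHomomorphism ι-hom
      module g = MorphismStructures.ModuleMorphisms.IsModuleHomomorphism g-hom

    M⊕N₂ : Module R (m ⊔ n₂) (ℓm ⊔ ℓ₂)
    M⊕N₂ = DirectProduct.⟨module⟩ M N₂

    ⟨g,-ι⟩ : N₁.Carrierᴹ → M.Carrierᴹ × N₂.Carrierᴹ
    ⟨g,-ι⟩ t = g t , N₂.-ᴹ ι t

    ⟨g,-ι⟩-hom : IsHom R N₁ M⊕N₂ ⟨g,-ι⟩
    ⟨g,-ι⟩-hom = mkIsHom N₁ M⊕N₂ ⟨g,-ι⟩
      (λ t≈t′ → g.⟦⟧-cong t≈t′ , N₂.-ᴹ‿cong (ι.⟦⟧-cong t≈t′))
      (λ t t′ → g.+ᴹ-homo t t′ ,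
        N₂.≈ᴹ-trans (N₂.-ᴹ‿cong (ι.+ᴹ-homo t t′)) (N₂.≈ᴹ-sym (⁻¹-∙-comm (ι t) (ι t′))))
      (λ r t → g.*ₗ-homo r t ,
        N₂.≈ᴹ-trans (N₂.-ᴹ‿cong (ι.*ₗ-homo r t)) (N₂.≈ᴹ-sym (Linear.-‿distribʳ-*ₗ N₂ r (ι t))))
      where open import Algebra.Properties.AbelianGroup N₂.+ᴹ-abelianGroup using (⁻¹-∙-comm)

    open Cokernel {K = N₁} {X = M⊕N₂} ⟨g,-ι⟩-hom public
      using (_≈f_; ≈ᴹ⇒≈f; ppEqn-coker) renaming (coker to P)

    inj₁ : M.Carrierᴹ → M.Carrierᴹ × N₂.Carrierᴹ
    inj₁ a = a , N₂.0ᴹ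

    inj₂ : N₂.Carrierᴹ → M.Carrierᴹ × N₂.Carrierᴹ
    inj₂ b = M.0ᴹ , b

    inj₁-hom : IsHom R M P inj₁
    inj₁-hom = mkIsHom M P inj₁ (λ a≈a′ → ≈ᴹ⇒≈f (a≈a′ , N₂.≈ᴹ-refl))
      (λ a a′ → ≈ᴹ⇒≈f (M.≈ᴹ-refl , N₂.≈ᴹ-sym (N₂.+ᴹ-identityˡ N₂.0ᴹ)))
      (λ r a → ≈ᴹ⇒≈f (M.≈ᴹ-refl , N₂.≈ᴹ-sym (N₂.*ₗ-zeroʳ r)))

    inj₂-hom : IsHom R N₂ P inj₂
    inj₂-hom = mkIsHom N₂ P inj₂ (λ b≈b′ → ≈ᴹ⇒≈f (M.≈ᴹ-refl , b≈b′))
      (λ b b′ → ≈ᴹ⇒≈f (M.≈ᴹ-sym (M.+ᴹ-identityˡ M.0ᴹ) , N₂.≈ᴹ-refl))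
      (λ r b → ≈ᴹ⇒≈f (M.≈ᴹ-sym (M.*ₗ-zeroʳ r) , N₂.≈ᴹ-refl))

    inj₁∘g≈inj₂∘ι : ∀ t → inj₁ (g t) ≈f inj₂ (ι t)
    inj₁∘g≈inj₂∘ι t = t , M.≈ᴹ-sym (M.+ᴹ-identityˡ (g t)) , N₂.≈ᴹ-sym (N₂.-ᴹ‿inverseʳ (ι t))

    proj₁-hom : IsHom R M⊕N₂ M proj₁
    proj₁-hom = mkIsHom M⊕N₂ M proj₁ proj₁ (λ _ _ → M.≈ᴹ-refl) (λ _ _ → M.≈ᴹ-refl)

    proj₂-hom : IsHom R M⊕N₂ N₂ proj₂
    proj₂-hom = mkIsHom M⊕N₂ N₂ proj₂ proj₂ (λ _ _ → N₂.≈ᴹ-refl) (λ _ _ → N₂.≈ᴹ-refl)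

    inj₁-injective : Injective N₁._≈ᴹ_ N₂._≈ᴹ_ ι → Injective M._≈ᴹ_ _≈f_ inj₁
    inj₁-injective ι-injective {a} {a′} (t , a≈a′+gt , 0≈0-ιt) = begin
      a             ≈⟨ a≈a′+gt ⟩
      a′ M.+ᴹ g t   ≈⟨ M.+ᴹ-congˡ (M.≈ᴹ-trans (g.⟦⟧-cong (ι-injective ιt≈ι0)) g.0ᴹ-homo) ⟩
      a′ M.+ᴹ M.0ᴹ  ≈⟨ M.+ᴹ-identityʳ a′ ⟩
      a′            ∎
      where
      open import Relation.Binary.Reasoning.Setoid M.≈ᴹ-setoid
      open import Algebra.Properties.AbelianGroup N₂.+ᴹ-abelianGroup using (⁻¹-involutive; ε⁻¹≈ε)
      ιt≈ι0 : ι t N₂.≈ᴹ ι N₁.0ᴹ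
      ιt≈ι0 = N₂.≈ᴹ-trans (N₂.≈ᴹ-sym (⁻¹-involutive (ι t)))
        (N₂.≈ᴹ-trans (N₂.-ᴹ‿cong (N₂.≈ᴹ-sym (N₂.≈ᴹ-trans 0≈0-ιt (N₂.+ᴹ-identityˡ _))))
          (N₂.≈ᴹ-trans ε⁻¹≈ε (N₂.≈ᴹ-sym ι.0ᴹ-homo)))

    -- A solution in P leaves residues (g tⱼ, −ι tⱼ) ∈ M ⊕ N₂.  Their N₂-part makes the y-part of
    -- the system solvable with right-hand side −ι t, so by purity it is solvable with −t in N₁,
    -- and adding g of that solution to the M-witnesses cancels the residues g tⱼ.
    inj₁-pure : ReflectsPP N₁ N₂ ι → ReflectsPP M P inj₁
    inj₁-pure ι-pure n φ x (y , eqs) = (λ l → u l M.+ᴹ g (v′ l)) , eqn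
      where
      open import Relation.Binary.Reasoning.Setoid M.≈ᴹ-setoid
      eqs′ : ∀ j → ppEqn R M⊕N₂ φ (inj₁ ∘ x) y j ≈f (M.0ᴹ , N₂.0ᴹ)
      eqs′ j = subst (_≈f (M.0ᴹ , N₂.0ᴹ)) (ppEqn-coker φ (inj₁ ∘ x) y j) (eqs j)
      t : Fin (e φ) → N₁.Carrierᴹ
      t j = proj₁ (eqs′ j)
      u = proj₁ ∘ y
      v = proj₂ ∘ y
      eqn-M : ∀ j → ppEqn R M φ x u j M.≈ᴹ g (t j)
      eqn-M j = M.≈ᴹ-trans (M.≈ᴹ-sym (hom-ppEqn M⊕N₂ M proj₁ proj₁-hom φ (inj₁ ∘ x) y j))
                  (M.≈ᴹ-trans (proj₁ (proj₂ (eqs′ j))) (M.+ᴹ-identityˡ (g (t j))))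

      eqn-N₂ : ∀ j → ppEqn R N₂ φ (λ _ → N₂.0ᴹ) v j N₂.+ᴹ ι (t j) N₂.≈ᴹ N₂.0ᴹ
      eqn-N₂ j = N₂.≈ᴹ-trans (N₂.+ᴹ-congʳ
          (N₂.≈ᴹ-trans (N₂.≈ᴹ-sym (hom-ppEqn M⊕N₂ N₂ proj₂ proj₂-hom φ (inj₁ ∘ x) y j))
            (N₂.≈ᴹ-trans (proj₂ (proj₂ (eqs′ j))) (N₂.+ᴹ-identityˡ _))))
        (N₂.-ᴹ‿inverseˡ (ι (t j)))

      v′ = proj₁ (pure-reflects-offset ι-hom ι-pure φ t (v , eqn-N₂))
      eqn-N₁ = proj₂ (pure-reflects-offset ι-hom ι-pure φ t (v , eqn-N₂))

      eqn : ∀ j → ppEqn R M φ x (λ l → u l M.+ᴹ g (v′ l)) j M.≈ᴹ M.0ᴹ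
      eqn j = begin
        ppEqn R M φ x (λ l → u l M.+ᴹ g (v′ l)) j
          ≈⟨ Linear.ppEqn-+ʸ M φ x u (g ∘ v′) j ⟩
        ppEqn R M φ x u j M.+ᴹ Linear._·_ M (B φ j) (g ∘ v′)
          ≈⟨ M.+ᴹ-cong (eqn-M j) (M.≈ᴹ-sym (hom-· N₁ M g g-hom (B φ j) v′)) ⟩
        g (t j) M.+ᴹ g (Linear._·_ N₁ (B φ j) v′)
          ≈⟨ M.≈ᴹ-trans (g.+ᴹ-homo _ _) (M.+ᴹ-comm _ _) ⟨
        g (Linear._·_ N₁ (B φ j) v′ N₁.+ᴹ t j)
          ≈⟨ g.⟦⟧-cong (N₁.+ᴹ-congʳ (Linear.ppEqn-0ˣ N₁ φ v′ j)) ⟨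
        g (ppEqn R N₁ φ (λ _ → N₁.0ᴹ) v′ j N₁.+ᴹ t j)
          ≈⟨ M.≈ᴹ-trans (g.⟦⟧-cong (eqn-N₁ j)) g.0ᴹ-homo ⟩
        M.0ᴹ ∎

    P/inj₁-𝔰Torsion : Is𝔰Torsion R N₂ → QuotientIs𝔰Torsion R M P inj₁
    P/inj₁-𝔰Torsion N₂-tor (a , b) with N₂-tor b
    ... | ψ , ψ-low , v , eqs = ψ , ψ-low , y , λ j → z j , residue j
      where
      p⃗ : Vector (M.Carrierᴹ × N₂.Carrierᴹ) 1
      p⃗ _ = a , b
      y : Fin (k ψ) → M.Carrierᴹ × N₂.Carrierᴹ
      y l = M.0ᴹ , v l
      z : Fin (e ψ) → M.Carrierᴹ
      z j = proj₁ (ppEqn R M⊕N₂ ψ p⃗ y j)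
      residue : ∀ j → ppEqn R P ψ p⃗ y j ≈f inj₁ (z j)
      residue j = subst (_≈f inj₁ (z j)) (sym (ppEqn-coker ψ p⃗ y j))
        (≈ᴹ⇒≈f (M.≈ᴹ-refl , N₂.≈ᴹ-trans (hom-ppEqn M⊕N₂ N₂ proj₂ proj₂-hom ψ p⃗ y j) (eqs j)))

  module _ {m : Level} {M : Module R m m} where
    private module M = Module M

    pureInjective⇒ultracomplete : Is𝔰Torsion R M →
                                  IsK𝔰TorPureInjective R M → IsTorsionUltracomplete R M
    pureInjective⇒ultracomplete M-tor pure-inj N ι ι-pure N/M-tor =
      pure-inj M N M-tor (Is𝔰Torsion-extension ι-hom M-tor N/M-tor) ι ι-pure id id-hom
      where
      open MorphismStructures.ModuleMorphisms.IsModuleMonomorphism (proj₁ ι-pure)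
        using () renaming (isModuleHomomorphism to ι-hom)
      id-hom = Identity.isModuleHomomorphism M.rawModule M.≈ᴹ-refl

    ultracomplete⇒pureInjective : IsTorsionUltracomplete R M → IsK𝔰TorPureInjective R M
    ultracomplete⇒pureInjective ultracomplete N₁ N₂ _ N₂-tor ι (ι-mono , ι-pure) g g-hom =
      extend (ultracomplete P inj₁ (inj₁-mono , inj₁-pure ι-pure) (P/inj₁-𝔰Torsion N₂-tor))
      where
      open MorphismStructures.ModuleMorphisms.IsModuleMonomorphism ι-mono
        using (injective) renaming (isModuleHomomorphism to ι-hom)
      open Pushout ι-hom g-hom
      inj₁-mono : IsMono R M P inj₁
      inj₁-mono = record { isModuleHomomorphism = inj₁-hom ; injective = inj₁-injective injective }
      extend : ∃[ π ] (IsHom R P M π × ∀ a → π (inj₁ a) M.≈ᴹ a) →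
               ∃[ h ] (IsHom R N₂ M h × ∀ t → h (ι t) M.≈ᴹ g t)
      extend (π , π-hom , π∘inj₁≈id) =
        π ∘ inj₂ , Composition.isModuleHomomorphism M.≈ᴹ-trans inj₂-hom π-hom ,
        λ t → M.≈ᴹ-trans (⟦⟧-cong (Module.≈ᴹ-sym P (inj₁∘g≈inj₂∘ι t))) (π∘inj₁≈id (g t))
        where open MorphismStructures.ModuleMorphisms.IsModuleHomomorphism π-hom using (⟦⟧-cong)

lemma3p14 : ∀ {c ℓr m : Level} (R : CommutativeRing c ℓr) → IsPruferDomain R →
            (M : Module R m m) → Is𝔰Torsion R M →
            (IsK𝔰TorPureInjective R M → IsTorsionUltracomplete R M)
            × (IsTorsionUltracomplete R M → IsK𝔰TorPureInjective R M)
lemma3p14 R _ M M-tor = pureInjective⇒ultracomplete R M-tor , ultracomplete⇒pureInjective R
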